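{- Let $\mathrm{sort}$ be a sort function satisfying the extended characteristic property. For every type $T$ and all total preorders $\leq_1, \leq_2$ on $T$, and every $s : \mathrm{list}\,T$, we have $\mathrm{sort}_{\leq_1}\,(\mathrm{sort}_{\leq_2}\,s) = \mathrm{sort}_{\leq_{\mathrm{lex}}}\,s$, where $x \leq_{\mathrm{lex}} y :\Leftrightarrow x \leq_1 y \wedge (y \not\leq_1 x \vee x \leq_2 y)$.
   Context: A total preorder is a relation that is transitive and total. Lists: $[]$ empty, $x :: s$ cons, $[x]$ singleton, $\mathbin{+\!\!+}$ concatenation, $\mathrm{rev}$ list reversal. A "relation" $\leq$ on a type $T$ is a function $T \to T \to \mathrm{bool}$. Merge: $[] \mathbin{\land\hspace{ -.45em}\land}_\leq ys = ys$, $xs \mathbin{\land\hspace{ -.45em}\land}_\leq [] = xs$, $(x :: xs) \mathbin{\land\hspace{ -.45em}\land}_\leq (y :: ys) = x :: (xs \mathbin{\land\hspace{ -.45em}\land}_\leq (y :: ys))$ if $x \leq y$, else $y :: ((x :: xs) \mathbin{\land\hspace{ -.45em}\land}_\leq ys)$. Define $xs \mathbin{\lor\hspace{ -.45em}\lor}_\leq ys := \mathrm{rev}\,(\mathrm{rev}\,ys \mathbin{\land\hspace{ -.45em}\land}_\geq \mathrm{rev}\,xs)$ where $\geq$ is the converse of $\leq$. A sort function assigns to every type $T$ and relation $\leq$ on $T$ a function $\mathrm{sort}_\leq : \mathrm{list}\,T \to \mathrm{list}\,T$. It satisfies the extended characteristic property if there is a polymorphic $\mathrm{asort}$ of type $\forall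 (T\,R:\mathcal{U}), (T\to T\to\mathrm{bool}) \to (R\to R\to R)\to(R\to R\to R)\to(T\to R)\to R\to\mathrm{list}\,T\to R$ such that (1) $\mathrm{asort}\,(\leq)\,(\mathbin{\land\hspace{ -.45em}\land}_\leq)\,(\mathbin{\lor\hspace{ -.45em}\lor}_\leq)\,(\lambda x.[x])\,[]\,xs = \mathrm{sort}_\leq\,xs$ for all $T,\leq,xs$; (2) $\mathrm{asort}\,(\leq)\,(\mathbin{+\!\!+})\,(\mathbin{+\!\!+})\,(\lambda x.[x])\,[]\,xs = xs$ for all $T,\leq,xs$; (3) $\mathrm{asort}$ is relationally parametric: for all types $T_1,T_2$, relation $\sim_T\subseteq T_1\times T_2$, types $R_1,R_2$, relation $\sim_R\subseteq R_1\times R_2$, all $\leq_i : T_i\to T_i\to\mathrm{bool}$ with $x_1\sim_T x_2\wedge y_1\sim_T y_2 \Rightarrow (x_1\leq_1 y_1)=(x_2\leq_2 y_2)$, all $m_i, m'_i : R_i\to R_i\to R_i$ each pair preserving $\sim_R$ (i.e. $a_1\sim_R a_2\wedge b_1\sim_R b_2\Rightarrow m_1 a_1 b_1 \sim_R m_2 a_2 b_2$, and likewise for $m'$), all $s_i:T_i\to R_i$ with $x_1\sim_T x_2\Rightarrow s_1x_1\sim_R s_2x_2$, all $e_i : R_i$ with $e_1\sim_R e_2$, and all equal-length pointwise $\sim_T$-related lists $xs_1, xs_2$: $\mathrm{asort}\,(\leq_1)\,m_1\,m'_1\,s_1\,e_1\,xs_1 \sim_R \mathrm{asort}\,(\leq_2)\,m_2\,m'_2\,s_2\,e_2\,xs_2$.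 -}

module Defs where

open import Data.Bool using (Bool; true; false; if_then_else_; _∧_; _∨_; not)
open import Data.List using (List; []; _∷_; _++_; reverse; [_])
open import Data.List.Relation.Binary.Pointwise using (Pointwise)
open import Data.Product using (Σ; _×_)
open import Data.Sum using (_⊎_)
open import Relation.Binary.PropositionalEquality using (_≡_)

Rel : Set → Set
Rel T = T → T → Bool

flipR : {T : Set} → Rel T → Rel T
flipR le x y = le y x

merge : {T : Set} → Rel T → List T → List T → List T
merge le [] ys = ys
merge le (x ∷ xs) [] = x ∷ xs
merge le (x ∷ xs) (y ∷ ys) =
  if le x y then x ∷ merge le xs (y ∷ ys) else y ∷ merge le (x ∷ xs) ys

mergeRev : {T : Set} → Rel T → List T → List T → List T
mergeRev le xs ys = reverse (merge (flipR le) (reverse ys) (reverse xs))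

Transitive : {T : Set} → Rel T → Set
Transitive le = ∀ x y z → le x y ≡ true → le y z ≡ true → le x z ≡ true

Total : {T : Set} → Rel T → Set
Total le = ∀ x y → (le x y ≡ true) ⊎ (le y x ≡ true)

TotalPreorder : {T : Set} → Rel T → Set
TotalPreorder le = Transitive le × Total le

SortFunction : Set₁
SortFunction = {T : Set} → Rel T → List T → List T

ASortType : Set₁
ASortType = (T R : Set) → Rel T → (R → R → R) → (R → R → R) → (T → R) → R → List T → R

Parametric : ASortType → Set₁
Parametric asort =
  (T₁ T₂ : Set) (∼T : T₁ → T₂ → Set) (R₁ R₂ : Set) (∼R : R₁ → R₂ → Set)
  (le₁ : Rel T₁) (le₂ : Rel T₂) →
  (∀ {x₁ x₂ y₁ y₂} → ∼T x₁ x₂ → ∼T y₁ y₂ → le₁ x₁ y₁ ≡ le₂ x₂ y₂) →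
  (m₁ m'₁ : R₁ → R₁ → R₁) (m₂ m'₂ : R₂ → R₂ → R₂) →
  (∀ {a₁ a₂ b₁ b₂} → ∼R a₁ a₂ → ∼R b₁ b₂ → ∼R (m₁ a₁ b₁) (m₂ a₂ b₂)) →
  (∀ {a₁ a₂ b₁ b₂} → ∼R a₁ a₂ → ∼R b₁ b₂ → ∼R (m'₁ a₁ b₁) (m'₂ a₂ b₂)) →
  (s₁ : T₁ → R₁) (s₂ : T₂ → R₂) →
  (∀ {x₁ x₂} → ∼T x₁ x₂ → ∼R (s₁ x₁) (s₂ x₂)) →
  (e₁ : R₁) (e₂ : R₂) → ∼R e₁ e₂ →
  (xs₁ : List T₁) (xs₂ : List T₂) → Pointwise ∼T xs₁ xs₂ →
  ∼R (asort T₁ R₁ le₁ m₁ m'₁ s₁ e₁ xs₁) (asort T₂ R₂ le₂ m₂ m'₂ s₂ e₂ xs₂)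

ExtendedCharacteristicProperty : SortFunction → Set₁
ExtendedCharacteristicProperty sort =
  Σ ASortType λ asort →
    ((T : Set) (le : Rel T) (xs : List T) →
       asort T (List T) le (merge le) (mergeRev le) [_] [] xs ≡ sort le xs)
  × ((T : Set) (le : Rel T) (xs : List T) →
       asort T (List T) le _++_ _++_ [_] [] xs ≡ xs)
  × Parametric asort

lexR : {T : Set} → Rel T → Rel T → Rel T
lexR le₁ le₂ x y = le₁ x y ∧ (not (le₁ y x) ∨ le₂ x y)

module Submission where

-- Call P a block for ≤ if any two elements satisfying P are ≤-related, as in an
-- equivalence class of ≤.  When merge emits the head y of its second argument
-- before the head x of the first, x ≰ y, so no element of the first argument is
-- in y's block; hence merging sorted lists keeps the P-elements of the first
-- before those of the second.  The relation "xs is sorted and has the same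
-- P-subsequence as ys" thus relates merge (and its reversed variant) to
-- concatenation, and by parametricity it relates sort ≤ xs to xs: sort is
-- sorted and stable on every block.  A list sorted for a total preorder is
-- determined by the subsequences of its equivalence classes.  Both sides of the
-- theorem are ≤lex-sorted, and as a ≤lex-class is a block for ≤₁ and for ≤₂,
-- both have the same subsequence on it as s.

open import Defs
open import Data.Bool using (true; false; if_then_else_)
open import Data.Empty using (⊥)
open import Data.List using (List; []; _∷_; _++_; reverse; [_]; filter)
open import Data.List.Properties
  using (filter-++; filter-none; filter-accept; ++-identityʳ; unfold-reverse;
         reverse-++; reverse-involutive; ∷-injective; ∷-injectiveˡ)
open import Data.List.Membership.Propositional using (_∈_)
open import Data.List.Membership.Propositional.Properties using (∈-filter⁺; ∈-filter⁻)
open import Data.List.Relation.Unary.All as All using (All; []; _∷_)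
import Data.List.Relation.Unary.All.Properties as All
open import Data.List.Relation.Unary.AllPairs as AllPairs using (AllPairs; []; _∷_)
import Data.List.Relation.Unary.AllPairs.Properties as AllPairsₚ
open import Data.List.Relation.Unary.Any using (here; there)
import Data.List.Relation.Unary.Any.Properties as Any
import Data.List.Relation.Binary.Pointwise as Pointwise
open import Data.Bool.Properties using (_≟_)
open import Data.Product using (_×_; _,_; proj₁; proj₂)
open import Data.Sum using (_⊎_; inj₁; inj₂; swap)
open import Relation.Nullary using (yes; no; _×-dec_; contradiction)
open import Function using (_∘_; flip)
open import Level using (0ℓ)
open import Relation.Unary using (Pred; Decidable; ∁; ∅)
open import Relation.Unary.Properties using (∅?)
open import Relation.Binary.PropositionalEquality
  using (_≡_; refl; sym; trans; cong; cong₂; subst; subst₂; module ≡-Reasoning)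

private variable
  A : Set
  le le₁ le₂ : Rel A
  x y : A
  xs ys : List A

Sorted : Rel A → List A → Set
Sorted le = AllPairs (λ x y → le x y ≡ true)

Block : Rel A → Pred A 0ℓ → Set
Block le P = ∀ u v → P u → P v → le u v ≡ true

block-⊆ : {P Q : Pred A 0ℓ} → Block le P → (∀ {u} → Q u → P u) → Block le Q
block-⊆ block Q⊆P u v qu qv = block u v (Q⊆P qu) (Q⊆P qv)

flip-block : {P : Pred A 0ℓ} → Block le P → Block (flipR le) P
flip-block block u v pu pv = block v u pv pu

Equivalent : Rel A → A → A → Set
Equivalent le x y = le x y ≡ true × le y x ≡ true

equivalent? : (le : Rel A) (x : A) → Decidable (Equivalent le x)
equivalent? le x y = (le x y ≟ true) ×-dec (le y x ≟ true)

total⇒refl : Total le → ∀ x → le x x ≡ true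
total⇒refl ≤-total x with ≤-total x x
... | inj₁ x≤x = x≤x
... | inj₂ x≤x = x≤x

total⇒equivalent-refl : Total le → ∀ x → Equivalent le x x
total⇒equivalent-refl ≤-total x = total⇒refl ≤-total x , total⇒refl ≤-total x

equivalent-block : Transitive le → Block le (Equivalent le x)
equivalent-block {x = x} ≤-trans u v (_ , u≤x) (x≤v , _) = ≤-trans u x v u≤x x≤v

total⇒≤-flip : Total le → le x y ≡ false → le y x ≡ true
total⇒≤-flip {x = x} {y} ≤-total x≰y with ≤-total x y
... | inj₁ x≤y with () ← trans (sym x≤y) x≰y
... | inj₂ y≤x = y≤x

flip-transitive : Transitive le → Transitive (flipR le)
flip-transitive ≤-trans x y z x≥y y≥z = ≤-trans z y x y≥z x≥y

flip-totalPreorder : TotalPreorder le → TotalPreorder (flipR le)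
flip-totalPreorder (≤-trans , ≤-total) = flip-transitive ≤-trans , λ x y → ≤-total y x

sorted-reverse : Sorted le xs → Sorted (flipR le) (reverse xs)
sorted-reverse {xs = []} [] = []
sorted-reverse {xs = x ∷ xs} (x≤xs ∷ sorted) rewrite unfold-reverse x xs =
  AllPairsₚ.++⁺ (sorted-reverse sorted) ([] ∷ [])
    (All.map (λ x≤z → x≤z ∷ [])
      (All.tabulate (λ z∈rev → All.lookup x≤xs (Any.reverse⁻ z∈rev))))

module _ {P : Pred A 0ℓ} (P? : Decidable P) where

  filter-reverse : ∀ xs → filter P? (reverse xs) ≡ reverse (filter P? xs)
  filter-reverse [] = refl
  filter-reverse (x ∷ xs) = begin
    filter P? (reverse (x ∷ xs))              ≡⟨ cong (filter P?) (unfold-reverse x xs) ⟩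
    filter P? (reverse xs ++ [ x ])           ≡⟨ filter-++ P? (reverse xs) [ x ] ⟩
    filter P? (reverse xs) ++ filter P? [ x ] ≡⟨ cong (_++ _) (filter-reverse xs) ⟩
    reverse (filter P? xs) ++ filter P? [ x ] ≡⟨ snoc-filter ⟩
    reverse (filter P? (x ∷ xs))              ∎
    where
    open ≡-Reasoning
    snoc-filter : reverse (filter P? xs) ++ filter P? [ x ] ≡ reverse (filter P? (x ∷ xs))
    snoc-filter with P? x
    ... | yes _ = sym (unfold-reverse x (filter P? xs))
    ... | no _  = ++-identityʳ _

  filter-cons-cancel : filter P? (x ∷ xs) ≡ filter P? (x ∷ ys) →
    filter P? xs ≡ filter P? ys
  filter-cons-cancel {x = x} eq with P? x
  ... | yes _ = proj₂ (∷-injective eq)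
  ... | no _  = eq

  sorted-filter-tail : Sorted le (filter P? (x ∷ xs)) → Sorted le (filter P? xs)
  sorted-filter-tail {x = x} sorted with P? x
  ... | yes _ = AllPairs.tail sorted
  ... | no _  = sorted

-- Used instead of `with`, under which the termination checker rejects the
-- lexicographic recursion of the merge lemmas.
if-elim : ∀ {B : Set} (Q : B → Set) b {t f : B} →
  (b ≡ true → Q t) → (b ≡ false → Q f) → Q (if b then t else f)
if-elim Q true  onTrue onFalse = onTrue refl
if-elim Q false onTrue onFalse = onFalse refl

merge-All : ∀ {Q : Pred A 0ℓ} {le xs ys} → All Q xs → All Q ys → All Q (merge le xs ys)
merge-All [] qys = qys
merge-All qxs@(_ ∷ _) [] = qxs
merge-All {Q = Q} {le} qxs@(_∷_ {x} qx qxs′) qys@(_∷_ {y} qy qys′) =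
  if-elim (All Q) (le x y)
    (λ _ → qx ∷ merge-All qxs′ qys)
    (λ _ → qy ∷ merge-All qxs qys′)

merge-sorted : TotalPreorder le → Sorted le xs → Sorted le ys → Sorted le (merge le xs ys)
merge-sorted _ [] sorted₂ = sorted₂
merge-sorted _ sorted₁@(_ ∷ _) [] = sorted₁
merge-sorted {le = le} tp@(≤-trans , ≤-total)
  sorted₁@(_∷_ {x} x≤xs sorted₁′) sorted₂@(_∷_ {y} y≤ys sorted₂′) =
  if-elim (Sorted le) (le x y)
    (λ x≤y → merge-All x≤xs (x≤y ∷ All.map (≤-trans x y _ x≤y) y≤ys)
             ∷ merge-sorted tp sorted₁′ sorted₂)
    (λ x≰y → let y≤x = total⇒≤-flip ≤-total x≰y in
             merge-All (y≤x ∷ All.map (≤-trans y x _ y≤x) x≤xs) y≤ys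
             ∷ merge-sorted tp sorted₁ sorted₂′)

mergeRev-sorted : TotalPreorder le → Sorted le xs → Sorted le ys →
  Sorted le (mergeRev le xs ys)
mergeRev-sorted tp sorted₁ sorted₂ = sorted-reverse
  (merge-sorted (flip-totalPreorder tp) (sorted-reverse sorted₂) (sorted-reverse sorted₁))

module _ {P : Pred A 0ℓ} (P? : Decidable P) where

  filter-cons-left : ∀ {zs} r → filter P? zs ≡ filter P? xs ++ r →
    filter P? (x ∷ zs) ≡ filter P? (x ∷ xs) ++ r
  filter-cons-left {x = x} r eq with P? x
  ... | yes _ = cong (x ∷_) eq
  ... | no _  = eq

  filter-cons-right : ∀ {zs} → (P y → filter P? xs ≡ []) →
    filter P? zs ≡ filter P? xs ++ filter P? ys →
    filter P? (y ∷ zs) ≡ filter P? xs ++ filter P? (y ∷ ys)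
  filter-cons-right {y = y} {xs} {ys} none eq with P? y
  ... | no _  = eq
  ... | yes py = begin
    y ∷ _                            ≡⟨ cong (y ∷_) eq ⟩
    y ∷ filter P? xs ++ filter P? ys ≡⟨ cong (λ l → y ∷ l ++ _) (none py) ⟩
    y ∷ filter P? ys                 ≡⟨ cong (_++ _) (none py) ⟨
    filter P? xs ++ y ∷ filter P? ys ∎
    where open ≡-Reasoning

  block-excludes-greater : Transitive le → Block le P → le x y ≡ false →
    Sorted le (x ∷ xs) → P y → All (∁ P) (x ∷ xs)
  block-excludes-greater {le = le} {x = x} {y} ≤-trans block x≰y (x≤xs ∷ _) py =
    (λ px → ¬x≤y (block x y px py))
    ∷ All.map (λ {z} x≤z pz → ¬x≤y (≤-trans x z y x≤z (block z y pz py))) x≤xs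
    where
    ¬x≤y : le x y ≡ true → ⊥
    ¬x≤y x≤y with () ← trans (sym x≤y) x≰y

  filter-merge : Transitive le → Block le P → Sorted le xs → Sorted le ys →
    filter P? (merge le xs ys) ≡ filter P? xs ++ filter P? ys
  filter-merge _ _ [] _ = refl
  filter-merge _ _ (_ ∷ _) [] = sym (++-identityʳ _)
  filter-merge {le = le} ≤-trans block
    sorted₁@(_∷_ {x} {xs} _ sorted₁′) sorted₂@(_∷_ {y} {ys} _ sorted₂′) =
    if-elim (λ zs → filter P? zs ≡ filter P? (x ∷ xs) ++ filter P? (y ∷ ys)) (le x y)
      (λ _ → filter-cons-left (filter P? (y ∷ ys))
               (filter-merge ≤-trans block sorted₁′ sorted₂))
      (λ x≰y → filter-cons-right
               (λ py → filter-none P?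
                         (block-excludes-greater ≤-trans block x≰y sorted₁ py))
               (filter-merge ≤-trans block sorted₁ sorted₂′))

  filter-mergeRev : Transitive le → Block le P → Sorted le xs → Sorted le ys →
    filter P? (mergeRev le xs ys) ≡ filter P? xs ++ filter P? ys
  filter-mergeRev {le = le} {xs} {ys} ≤-trans block sorted₁ sorted₂ = begin
    filter P? (reverse (merge (flipR le) (reverse ys) (reverse xs)))
      ≡⟨ filter-reverse P? (merge (flipR le) (reverse ys) (reverse xs)) ⟩
    reverse (filter P? (merge (flipR le) (reverse ys) (reverse xs)))
      ≡⟨ cong reverse (filter-merge (flip-transitive ≤-trans) (flip-block block)
           (sorted-reverse sorted₂) (sorted-reverse sorted₁)) ⟩
    reverse (filter P? (reverse ys) ++ filter P? (reverse xs))
      ≡⟨ reverse-++ (filter P? (reverse ys)) (filter P? (reverse xs)) ⟩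
    reverse (filter P? (reverse xs)) ++ reverse (filter P? (reverse ys))
      ≡⟨ cong₂ _++_ (filter-reverse-reverse xs) (filter-reverse-reverse ys) ⟩
    filter P? xs ++ filter P? ys ∎
    where
    open ≡-Reasoning
    filter-reverse-reverse : ∀ zs → reverse (filter P? (reverse zs)) ≡ filter P? zs
    filter-reverse-reverse zs =
      trans (cong reverse (filter-reverse P? zs)) (reverse-involutive (filter P? zs))

module _ {sort : SortFunction} (ecp : ExtendedCharacteristicProperty sort)
         {le : Rel A} (tp : TotalPreorder le) where

  sort-sorted-stable : {P : Pred A 0ℓ} (P? : Decidable P) → Block le P → ∀ xs →
    Sorted le (sort le xs) × filter P? (sort le xs) ≡ filter P? xs
  sort-sorted-stable {P} P? block xs =
    let asort , asort-merge , asort-++ , parametric = ecp in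
    subst₂ Related (asort-merge A le xs) (asort-++ A le xs)
      (parametric A A _≡_ (List A) (List A) Related le le (λ { refl refl → refl })
        (merge le) (mergeRev le) _++_ _++_
        (λ {ys₁ zs₁ ys₂ zs₂} → merge-related {ys₁} {zs₁} {ys₂} {zs₂})
        (λ {ys₁ zs₁ ys₂ zs₂} → mergeRev-related {ys₁} {zs₁} {ys₂} {zs₂})
        [_] [_] (λ { refl → [] ∷ [] , refl }) [] [] ([] , refl)
        xs xs (Pointwise.refl refl))
    where
    Related : List A → List A → Set
    Related ys zs = Sorted le ys × filter P? ys ≡ filter P? zs
    merge-related : ∀ {ys₁ zs₁ ys₂ zs₂} →
      Related ys₁ zs₁ → Related ys₂ zs₂ →
      Related (merge le ys₁ ys₂) (zs₁ ++ zs₂)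
    merge-related {zs₁ = zs₁} {zs₂ = zs₂} (sorted₁ , eq₁) (sorted₂ , eq₂) =
      merge-sorted tp sorted₁ sorted₂ ,
      trans (filter-merge P? (proj₁ tp) block sorted₁ sorted₂)
            (trans (cong₂ _++_ eq₁ eq₂) (sym (filter-++ P? zs₁ zs₂)))
    mergeRev-related : ∀ {ys₁ zs₁ ys₂ zs₂} →
      Related ys₁ zs₁ → Related ys₂ zs₂ →
      Related (mergeRev le ys₁ ys₂) (zs₁ ++ zs₂)
    mergeRev-related {zs₁ = zs₁} {zs₂ = zs₂} (sorted₁ , eq₁) (sorted₂ , eq₂) =
      mergeRev-sorted tp sorted₁ sorted₂ ,
      trans (filter-mergeRev P? (proj₁ tp) block sorted₁ sorted₂)
            (trans (cong₂ _++_ eq₁ eq₂) (sym (filter-++ P? zs₁ zs₂)))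

  sort-sorted : ∀ xs → Sorted le (sort le xs)
  sort-sorted xs = proj₁ (sort-sorted-stable ∅? (λ _ _ ()) xs)

  sort-stable : {P : Pred A 0ℓ} (P? : Decidable P) → Block le P → ∀ xs →
    filter P? (sort le xs) ≡ filter P? xs
  sort-stable P? block xs = proj₂ (sort-sorted-stable P? block xs)

SameClasses : Rel A → List A → List A → Set
SameClasses le xs ys = ∀ x → filter (equivalent? le x) xs ≡ filter (equivalent? le x) ys

sameClasses-∈ : Total le → SameClasses le xs ys → x ∈ xs → x ∈ ys
sameClasses-∈ {le = le} {x = x} ≤-total same x∈xs =
  proj₁ (∈-filter⁻ (equivalent? le x)
    (subst (x ∈_) (same x)
      (∈-filter⁺ (equivalent? le x) x∈xs (total⇒equivalent-refl ≤-total x))))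

sorted-head-≤ : Total le → Sorted le (y ∷ ys) → x ∈ y ∷ ys → le y x ≡ true
sorted-head-≤ ≤-total _ (here refl) = total⇒refl ≤-total _
sorted-head-≤ _ (y≤ys ∷ _) (there x∈ys) = All.lookup y≤ys x∈ys

sorted-unique : Total le → Sorted le xs → Sorted le ys → SameClasses le xs ys → xs ≡ ys
sorted-unique _ [] [] _ = refl
sorted-unique ≤-total [] (_ ∷ _) same
  with () ← sameClasses-∈ {ys = []} ≤-total (sym ∘ same) (here refl)
sorted-unique ≤-total (_ ∷ _) [] same
  with () ← sameClasses-∈ {ys = []} ≤-total same (here refl)
sorted-unique {le = le} ≤-total
  sorted₁@(_∷_ {x} {xs} _ sorted₁′) sorted₂@(_∷_ {y} {ys} _ sorted₂′) same =
  cong₂ _∷_ x≡y (sorted-unique ≤-total sorted₁′ sorted₂′ same-tails)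
  where
  x≈y : Equivalent le x y
  x≈y = sorted-head-≤ ≤-total sorted₁ (sameClasses-∈ ≤-total (sym ∘ same) (here refl))
      , sorted-head-≤ ≤-total sorted₂ (sameClasses-∈ ≤-total same (here refl))
  x≡y : x ≡ y
  x≡y = ∷-injectiveˡ (begin
    x ∷ filter x≈? xs   ≡⟨ filter-accept x≈? (total⇒equivalent-refl ≤-total x) ⟨
    filter x≈? (x ∷ xs) ≡⟨ same x ⟩
    filter x≈? (y ∷ ys) ≡⟨ filter-accept x≈? x≈y ⟩
    y ∷ filter x≈? ys   ∎)
    where
    open ≡-Reasoning
    x≈? = equivalent? le x
  same-tails : SameClasses le xs ys
  same-tails z = filter-cons-cancel (equivalent? le z)
    (trans (same z) (cong (λ w → filter (equivalent? le z) (w ∷ ys)) (sym x≡y)))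

module _ {le₁ le₂ : Rel A} where

  lex⇒≤₁ : lexR le₁ le₂ x y ≡ true → le₁ x y ≡ true
  lex⇒≤₁ {x = x} {y} x≤y with le₁ x y | x≤y
  ... | true | _ = refl

  lex⇒≤₂ : lexR le₁ le₂ x y ≡ true → le₁ y x ≡ true → le₂ x y ≡ true
  lex⇒≤₂ {x = x} {y} x≤y y≤₁x with le₁ x y | le₁ y x | le₂ x y | x≤y | y≤₁x
  ... | true | true | true | _ | _ = refl

  lex-intro : le₁ x y ≡ true → (le₁ y x ≡ true → le₂ x y ≡ true) →
    lexR le₁ le₂ x y ≡ true
  lex-intro {x = x} {y} x≤₁y k with le₁ x y | le₁ y x | x≤₁y
  ... | true | false | _ = refl
  ... | true | true  | _ = k refl

  lex-totalPreorder : TotalPreorder le₁ → TotalPreorder le₂ →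
    TotalPreorder (lexR le₁ le₂)
  lex-totalPreorder (≤₁-trans , ≤₁-total) (≤₂-trans , ≤₂-total) =
    lex-trans , lex-total
    where
    lex-trans : Transitive (lexR le₁ le₂)
    lex-trans x y z x≤y y≤z = lex-intro (≤₁-trans x y z x≤₁y y≤₁z) λ z≤₁x →
      ≤₂-trans x y z (lex⇒≤₂ x≤y (≤₁-trans y z x y≤₁z z≤₁x))
                     (lex⇒≤₂ y≤z (≤₁-trans z x y z≤₁x x≤₁y))
      where
      x≤₁y = lex⇒≤₁ x≤y
      y≤₁z = lex⇒≤₁ y≤z
    lex-total-≤₁ : ∀ x y → le₁ x y ≡ true →
      lexR le₁ le₂ x y ≡ true ⊎ lexR le₁ le₂ y x ≡ true
    lex-total-≤₁ x y x≤₁y with le₁ y x ≟ true | ≤₂-total x y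
    ... | no y≰₁x  | _         = inj₁ (lex-intro x≤₁y (flip contradiction y≰₁x))
    ... | yes _    | inj₁ x≤₂y = inj₁ (lex-intro x≤₁y λ _ → x≤₂y)
    ... | yes y≤₁x | inj₂ y≤₂x = inj₂ (lex-intro y≤₁x λ _ → y≤₂x)
    lex-total : Total (lexR le₁ le₂)
    lex-total x y with ≤₁-total x y
    ... | inj₁ x≤₁y = lex-total-≤₁ x y x≤₁y
    ... | inj₂ y≤₁x = swap (lex-total-≤₁ y x y≤₁x)

  lex-equivalent⇒equivalent₁ : Equivalent (lexR le₁ le₂) x y → Equivalent le₁ x y
  lex-equivalent⇒equivalent₁ (x≤y , y≤x) = lex⇒≤₁ x≤y , lex⇒≤₁ y≤x

  lex-equivalent⇒equivalent₂ : Equivalent (lexR le₁ le₂) x y → Equivalent le₂ x y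
  lex-equivalent⇒equivalent₂ (x≤y , y≤x) =
    lex⇒≤₂ x≤y (lex⇒≤₁ y≤x) , lex⇒≤₂ y≤x (lex⇒≤₁ x≤y)

  lex-class-block₁ : Transitive le₁ → Block le₁ (Equivalent (lexR le₁ le₂) x)
  lex-class-block₁ ≤₁-trans =
    block-⊆ (equivalent-block ≤₁-trans) lex-equivalent⇒equivalent₁

  lex-class-block₂ : Transitive le₂ → Block le₂ (Equivalent (lexR le₁ le₂) x)
  lex-class-block₂ ≤₂-trans =
    block-⊆ (equivalent-block ≤₂-trans) lex-equivalent⇒equivalent₂

  lex-sorted : Total le₁ → Sorted le₁ xs →
    (∀ x → Sorted le₂ (filter (equivalent? le₁ x) xs)) → Sorted (lexR le₁ le₂) xs
  lex-sorted _ [] _ = []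
  lex-sorted ≤₁-total (_∷_ {x} {xs} x≤₁xs sorted) classes-sorted =
    All.tabulate (λ y∈xs → let x≤₁y = All.lookup x≤₁xs y∈xs in
      lex-intro x≤₁y λ y≤₁x →
        All.lookup x≤₂class (∈-filter⁺ (equivalent? le₁ x) y∈xs (x≤₁y , y≤₁x)))
    ∷ lex-sorted ≤₁-total sorted
        (λ z → sorted-filter-tail (equivalent? le₁ z) (classes-sorted z))
    where
    x≤₂class : All (λ y → le₂ x y ≡ true) (filter (equivalent? le₁ x) xs)
    x≤₂class = AllPairs.head (subst (Sorted le₂)
      (filter-accept (equivalent? le₁ x) (total⇒equivalent-refl ≤₁-total x))
      (classes-sorted x))

lemmaB16 : (sort : SortFunction) → ExtendedCharacteristicProperty sort →
    (T : Set) (le₁ le₂ : Rel T) → TotalPreorder le₁ → TotalPreorder le₂ →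
    (s : List T) → sort le₁ (sort le₂ s) ≡ sort (lexR le₁ le₂) s
lemmaB16 sort ecp T le₁ le₂ tp₁@(≤₁-trans , ≤₁-total) tp₂@(≤₂-trans , _) s =
  sorted-unique (proj₂ tp-lex) sorted-lex (sort-sorted ecp tp-lex s) same-classes
  where
  lex = lexR le₁ le₂
  tp-lex = lex-totalPreorder tp₁ tp₂

  ≤₁-classes-sorted : ∀ x →
    Sorted le₂ (filter (equivalent? le₁ x) (sort le₁ (sort le₂ s)))
  ≤₁-classes-sorted x = subst (Sorted le₂)
    (sym (sort-stable ecp tp₁ x≈₁? (equivalent-block ≤₁-trans) (sort le₂ s)))
    (AllPairsₚ.filter⁺ x≈₁? (sort-sorted ecp tp₂ s))
    where x≈₁? = equivalent? le₁ x

  sorted-lex : Sorted lex (sort le₁ (sort le₂ s))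
  sorted-lex = lex-sorted ≤₁-total (sort-sorted ecp tp₁ (sort le₂ s)) ≤₁-classes-sorted

  same-classes : SameClasses lex (sort le₁ (sort le₂ s)) (sort lex s)
  same-classes x = begin
    filter x≈? (sort le₁ (sort le₂ s))
      ≡⟨ sort-stable ecp tp₁ x≈? (lex-class-block₁ {le₂ = le₂} ≤₁-trans) _ ⟩
    filter x≈? (sort le₂ s)
      ≡⟨ sort-stable ecp tp₂ x≈? (lex-class-block₂ {le₁ = le₁} ≤₂-trans) s ⟩
    filter x≈? s
      ≡⟨ sort-stable ecp tp-lex x≈? (equivalent-block (proj₁ tp-lex)) s ⟨
    filter x≈? (sort lex s) ∎
    where
    open ≡-Reasoning
    x≈? = equivalent? lex x
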